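{- Let $\phi$ be a set of index variables, $\Phi$ a finite set of constraints on $\phi$, and $T,U$ sized types with $\phi;\Phi\vdash T\sqsubseteq U$. Then for every index $I$, either $U^{ -I}$ is undefined, or both $U^{ -I}$ and $T^{ -I}$ are defined and $\phi;\Phi\vdash T^{ -I}\sqsubseteq U^{ -I}$.
   Context: Indices: $I,J,K ::= i \mid f(I_1,\dots,I_n)$, with index variables $i$ and function symbols interpreted as functions $\mathbb N^n\to\mathbb N$ (including $+$, $\cdot$ and truncated subtraction, $n-m=0$ if $m\ge n$). Constraints $I\bowtie J$, $\bowtie\in\{\le,<,=,\ne\}$; $\phi;\Phi\vDash C$ means every valuation of the index variables satisfying all constraints in $\Phi$ satisfies $C$. Sized types: $\mathcal B ::= \mathsf{Nat}[I,J]\mid\mathsf{List}[I,J](\mathcal B)\mid\mathsf{Bool}$; $T ::= \mathcal B\mid\mathsf{ch}_I(\vec T)\mid\mathsf{in}_I(\vec T)\mid\mathsf{out}_I(\vec T)\mid\mathsf{serv}_I^{\forall\vec i.K}(\vec T)\mid\mathsf{iserv}_I^{\forall\vec i.K}(\vec T)\mid\mathsf{oserv}_I^{\forall\vec i.K}(\vec T)$ ($\vec i$ bound in $K,\vec T$). Subtyping $\phi;\Phi\vdash T\sqsubseteq U$ is generated by: $\mathsf{Nat}[I,J]\sqsubseteq\mathsf{Nat}[I',J']$ if $\phi;\Phi\vDash I'\le I$ and $\phi;\Phi\vDash J\le J'$; $\mathsf{List}[I,J](\mathcal B)\sqsubseteq\mathsf{List}[I',J'](\mathcal B')$ if moreover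 $\mathcal B\sqsubseteq\mathcal B'$; $\mathsf{Bool}\sqsubseteq\mathsf{Bool}$; $\mathsf{ch}_I(\vec T)\sqsubseteq\mathsf{ch}_J(\vec U)$ if $\phi;\Phi\vDash I=J$, $\vec T\sqsubseteq\vec U$ and $\vec U\sqsubseteq\vec T$ componentwise; $\mathsf{ch}_I(\vec T)\sqsubseteq\mathsf{in}_I(\vec T)$; $\mathsf{ch}_I(\vec T)\sqsubseteq\mathsf{out}_I(\vec T)$; $\mathsf{in}_I(\vec T)\sqsubseteq\mathsf{in}_J(\vec U)$ if $\phi;\Phi\vDash I=J$ and $\vec T\sqsubseteq\vec U$; $\mathsf{out}_I(\vec T)\sqsubseteq\mathsf{out}_J(\vec U)$ if $\phi;\Phi\vDash I=J$ and $\vec U\sqsubseteq\vec T$; $\mathsf{serv}_I^{\forall\vec i.K}(\vec T)\sqsubseteq\mathsf{serv}_J^{\forall\vec i.K'}(\vec U)$ if $\phi;\Phi\vDash I=J$, $(\phi,\vec i);\Phi\vdash\vec T\sqsubseteq\vec U$, $(\phi,\vec i);\Phi\vdash\vec U\sqsubseteq\vec T$, $(\phi,\vec i);\Phi\vDash K=K'$; $\mathsf{serv}_I^{\forall\vec i.K}(\vec T)\sqsubseteq\mathsf{iserv}_I^{\forall\vec i.K}(\vec T)$; $\mathsf{serv}_I^{\forall\vec i.K}(\vec T)\sqsubseteq\mathsf{oserv}_I^{\forall\vec i.K}(\vec T)$; $\mathsf{iserv}_I^{\forall\vec i.K}(\vec T)\sqsubseteq\mathsf{iserv}_J^{\forall\vec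 i.K'}(\vec U)$ if $\phi;\Phi\vDash I=J$, $(\phi,\vec i);\Phi\vdash\vec T\sqsubseteq\vec U$, $(\phi,\vec i);\Phi\vDash K'\le K$; $\mathsf{oserv}_I^{\forall\vec i.K}(\vec T)\sqsubseteq\mathsf{oserv}_J^{\forall\vec i.K'}(\vec U)$ if $\phi;\Phi\vDash I=J$, $(\phi,\vec i);\Phi\vdash\vec U\sqsubseteq\vec T$, $(\phi,\vec i);\Phi\vDash K\le K'$; transitivity. Advancing time $T^{ -I}$ (relative to $\phi;\Phi$): $\mathcal B^{ -I}=\mathcal B$; for $\chi\in\{\mathsf{ch},\mathsf{in},\mathsf{out}\}$, $\chi_J(\vec T)^{ -I}=\chi_{J-I}(\vec T)$ if $\phi;\Phi\vDash J\ge I$ and undefined otherwise; $\mathsf{serv}_J^{\forall\vec i.K}(\vec T)^{ -I}=\mathsf{serv}_{J-I}^{\forall\vec i.K}(\vec T)$ if $\phi;\Phi\vDash J\ge I$, and $\mathsf{oserv}_{J-I}^{\forall\vec i.K}(\vec T)$ otherwise; $\mathsf{iserv}_J^{\forall\vec i.K}(\vec T)^{ -I}=\mathsf{iserv}_{J-I}^{\forall\vec i.K}(\vec T)$ if $\phi;\Phi\vDash J\ge I$, undefined otherwise; $\mathsf{oserv}_J^{\forall\vec i.K}(\vec T)^{ -I}=\mathsf{oserv}_{J-I}^{\forall\vec i.K}(\vec T)$. -}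

module Defs where

open import Data.Nat using (ℕ; _≤_; _<_; _∸_)
open import Data.Fin using (Fin; _↑ʳ_)
open import Data.Vec using (Vec; []; _∷_)
open import Data.List using (List; []; _∷_; map)
open import Data.List.Relation.Unary.All using (All)
open import Relation.Binary.PropositionalEquality using (_≡_; _≢_)
open import Relation.Nullary using (¬_)

-- Indices, scoped over n index variables (φ = Fin n).
-- Function symbols are given directly by their interpretation ℕ^m → ℕ.

data Index (n : ℕ) : Set where
  var : Fin n → Index n
  fun : {m : ℕ} → (Vec ℕ m → ℕ) → Vec (Index n) m → Index n

Val : ℕ → Set
Val n = Fin n → ℕ

mutual
  eval : {n : ℕ} → Val n → Index n → ℕ
  eval ρ (var x) = ρ x
  eval ρ (fun f is) = f (evals ρ is)

  evals : {n m : ℕ} → Val n → Vec (Index n) m → Vec ℕ m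
  evals ρ [] = []
  evals ρ (i ∷ is) = eval ρ i ∷ evals ρ is

monus : Vec ℕ 2 → ℕ
monus (a ∷ b ∷ []) = a ∸ b

_∸ᵢ_ : {n : ℕ} → Index n → Index n → Index n
I ∸ᵢ J = fun monus (I ∷ J ∷ [])

mutual
  wkI : {n : ℕ} (k : ℕ) → Index n → Index (k Data.Nat.+ n)
  wkI k (var x) = var (k ↑ʳ x)
  wkI k (fun f is) = fun f (wkIs k is)

  wkIs : {n m : ℕ} (k : ℕ) → Vec (Index n) m → Vec (Index (k Data.Nat.+ n)) m
  wkIs k [] = []
  wkIs k (i ∷ is) = wkI k i ∷ wkIs k is

data Rel : Set where
  le lt eq ne : Rel

record Constr (n : ℕ) : Set where
  constructor _⟨_⟩_
  field
    lhs : Index n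
    rel : Rel
    rhs : Index n

Sat : {n : ℕ} → Val n → Constr n → Set
Sat ρ (I ⟨ le ⟩ J) = eval ρ I ≤ eval ρ J
Sat ρ (I ⟨ lt ⟩ J) = eval ρ I < eval ρ J
Sat ρ (I ⟨ eq ⟩ J) = eval ρ I ≡ eval ρ J
Sat ρ (I ⟨ ne ⟩ J) = eval ρ I ≢ eval ρ J

Cstrs : ℕ → Set
Cstrs n = List (Constr n)

_⊨_ : {n : ℕ} → Cstrs n → Constr n → Set
Φ ⊨ C = (ρ : Val _) → All (Sat ρ) Φ → Sat ρ C

wkC : {n : ℕ} (k : ℕ) → Constr n → Constr (k Data.Nat.+ n)
wkC k (I ⟨ r ⟩ J) = wkI k I ⟨ r ⟩ wkI k J

wkΦ : {n : ℕ} (k : ℕ) → Cstrs n → Cstrs (k Data.Nat.+ n)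
wkΦ k Φ = map (wkC k) Φ

-- Sized types. A server type serv_I^{∀ i⃗. K}(T⃗) binds k index variables
-- (the first k variables of the scope k + n) in K and T⃗.

data Base (n : ℕ) : Set where
  Nat  : Index n → Index n → Base n
  Lst  : Index n → Index n → Base n → Base n
  Bool : Base n

data Ty : ℕ → Set where
  base  : {n : ℕ} → Base n → Ty n
  ch    : {n : ℕ} → Index n → List (Ty n) → Ty n
  inp   : {n : ℕ} → Index n → List (Ty n) → Ty n
  out   : {n : ℕ} → Index n → List (Ty n) → Ty n
  serv  : {n : ℕ} → Index n → (k : ℕ) → Index (k Data.Nat.+ n) → List (Ty (k Data.Nat.+ n)) → Ty n
  iserv : {n : ℕ} → Index n → (k : ℕ) → Index (k Data.Nat.+ n) → List (Ty (k Data.Nat.+ n)) → Ty n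
  oserv : {n : ℕ} → Index n → (k : ℕ) → Index (k Data.Nat.+ n) → List (Ty (k Data.Nat.+ n)) → Ty n

data _⊢_⊑_ : {n : ℕ} → Cstrs n → Ty n → Ty n → Set
data _⊢_⊑*_ : {n : ℕ} → Cstrs n → List (Ty n) → List (Ty n) → Set

data _⊢_⊑*_ where
  []  : {n : ℕ} {Φ : Cstrs n} → Φ ⊢ [] ⊑* []
  _∷_ : {n : ℕ} {Φ : Cstrs n} {T U : Ty n} {Ts Us : List (Ty n)} →
        Φ ⊢ T ⊑ U → Φ ⊢ Ts ⊑* Us → Φ ⊢ (T ∷ Ts) ⊑* (U ∷ Us)

data _⊢_⊑_ where
  s-nat : {n : ℕ} {Φ : Cstrs n} {I J I' J' : Index n} →
          Φ ⊨ (I' ⟨ le ⟩ I) → Φ ⊨ (J ⟨ le ⟩ J') →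
          Φ ⊢ base (Nat I J) ⊑ base (Nat I' J')
  s-list : {n : ℕ} {Φ : Cstrs n} {I J I' J' : Index n} {B B' : Base n} →
          Φ ⊨ (I' ⟨ le ⟩ I) → Φ ⊨ (J ⟨ le ⟩ J') → Φ ⊢ base B ⊑ base B' →
          Φ ⊢ base (Lst I J B) ⊑ base (Lst I' J' B')
  s-bool : {n : ℕ} {Φ : Cstrs n} → Φ ⊢ base Bool ⊑ base Bool
  s-ch : {n : ℕ} {Φ : Cstrs n} {I J : Index n} {Ts Us : List (Ty n)} →
         Φ ⊨ (I ⟨ eq ⟩ J) → Φ ⊢ Ts ⊑* Us → Φ ⊢ Us ⊑* Ts →
         Φ ⊢ ch I Ts ⊑ ch J Us
  s-ch-in : {n : ℕ} {Φ : Cstrs n} {I : Index n} {Ts : List (Ty n)} →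
         Φ ⊢ ch I Ts ⊑ inp I Ts
  s-ch-out : {n : ℕ} {Φ : Cstrs n} {I : Index n} {Ts : List (Ty n)} →
         Φ ⊢ ch I Ts ⊑ out I Ts
  s-in : {n : ℕ} {Φ : Cstrs n} {I J : Index n} {Ts Us : List (Ty n)} →
         Φ ⊨ (I ⟨ eq ⟩ J) → Φ ⊢ Ts ⊑* Us →
         Φ ⊢ inp I Ts ⊑ inp J Us
  s-out : {n : ℕ} {Φ : Cstrs n} {I J : Index n} {Ts Us : List (Ty n)} →
         Φ ⊨ (I ⟨ eq ⟩ J) → Φ ⊢ Us ⊑* Ts →
         Φ ⊢ out I Ts ⊑ out J Us
  s-serv : {n k : ℕ} {Φ : Cstrs n} {I J : Index n} {K K' : Index (k Data.Nat.+ n)}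
           {Ts Us : List (Ty (k Data.Nat.+ n))} →
         Φ ⊨ (I ⟨ eq ⟩ J) → wkΦ k Φ ⊢ Ts ⊑* Us → wkΦ k Φ ⊢ Us ⊑* Ts →
         wkΦ k Φ ⊨ (K ⟨ eq ⟩ K') →
         Φ ⊢ serv I k K Ts ⊑ serv J k K' Us
  s-serv-iserv : {n k : ℕ} {Φ : Cstrs n} {I : Index n} {K : Index (k Data.Nat.+ n)}
           {Ts : List (Ty (k Data.Nat.+ n))} →
         Φ ⊢ serv I k K Ts ⊑ iserv I k K Ts
  s-serv-oserv : {n k : ℕ} {Φ : Cstrs n} {I : Index n} {K : Index (k Data.Nat.+ n)}
           {Ts : List (Ty (k Data.Nat.+ n))} →
         Φ ⊢ serv I k K Ts ⊑ oserv I k K Ts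
  s-iserv : {n k : ℕ} {Φ : Cstrs n} {I J : Index n} {K K' : Index (k Data.Nat.+ n)}
           {Ts Us : List (Ty (k Data.Nat.+ n))} →
         Φ ⊨ (I ⟨ eq ⟩ J) → wkΦ k Φ ⊢ Ts ⊑* Us →
         wkΦ k Φ ⊨ (K' ⟨ le ⟩ K) →
         Φ ⊢ iserv I k K Ts ⊑ iserv J k K' Us
  s-oserv : {n k : ℕ} {Φ : Cstrs n} {I J : Index n} {K K' : Index (k Data.Nat.+ n)}
           {Ts Us : List (Ty (k Data.Nat.+ n))} →
         Φ ⊨ (I ⟨ eq ⟩ J) → wkΦ k Φ ⊢ Us ⊑* Ts →
         wkΦ k Φ ⊨ (K ⟨ le ⟩ K') →
         Φ ⊢ oserv I k K Ts ⊑ oserv J k K' Us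
  s-trans : {n : ℕ} {Φ : Cstrs n} {T U V : Ty n} →
         Φ ⊢ T ⊑ U → Φ ⊢ U ⊑ V → Φ ⊢ T ⊑ V

-- Advancing time, as the graph of the partial function:
-- Adv Φ I T T'  means  T^{-I} is defined (relative to φ;Φ) and equals T'.

data Adv {n : ℕ} (Φ : Cstrs n) (I : Index n) : Ty n → Ty n → Set where
  a-base  : {B : Base n} → Adv Φ I (base B) (base B)
  a-ch    : {J : Index n} {Ts : List (Ty n)} → Φ ⊨ (I ⟨ le ⟩ J) →
            Adv Φ I (ch J Ts) (ch (J ∸ᵢ I) Ts)
  a-in    : {J : Index n} {Ts : List (Ty n)} → Φ ⊨ (I ⟨ le ⟩ J) →
            Adv Φ I (inp J Ts) (inp (J ∸ᵢ I) Ts)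
  a-out   : {J : Index n} {Ts : List (Ty n)} → Φ ⊨ (I ⟨ le ⟩ J) →
            Adv Φ I (out J Ts) (out (J ∸ᵢ I) Ts)
  a-serv  : {J : Index n} {k : ℕ} {K : Index (k Data.Nat.+ n)} {Ts : List (Ty (k Data.Nat.+ n))} →
            Φ ⊨ (I ⟨ le ⟩ J) →
            Adv Φ I (serv J k K Ts) (serv (J ∸ᵢ I) k K Ts)
  a-serv' : {J : Index n} {k : ℕ} {K : Index (k Data.Nat.+ n)} {Ts : List (Ty (k Data.Nat.+ n))} →
            ¬ (Φ ⊨ (I ⟨ le ⟩ J)) →
            Adv Φ I (serv J k K Ts) (oserv (J ∸ᵢ I) k K Ts)
  a-iserv : {J : Index n} {k : ℕ} {K : Index (k Data.Nat.+ n)} {Ts : List (Ty (k Data.Nat.+ n))} →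
            Φ ⊨ (I ⟨ le ⟩ J) →
            Adv Φ I (iserv J k K Ts) (iserv (J ∸ᵢ I) k K Ts)
  a-oserv : {J : Index n} {k : ℕ} {K : Index (k Data.Nat.+ n)} {Ts : List (Ty (k Data.Nat.+ n))} →
            Adv Φ I (oserv J k K Ts) (oserv (J ∸ᵢ I) k K Ts)

module Submission where

-- Advancing time can be pulled back along subtyping: if T ⊑ U and U^{-I} is
-- defined, then T^{-I} is defined and below it, by induction on the derivation
-- (transitivity simply composes the two pull-backs). The one case with no
-- constructive witness is serv ⊑ oserv: oserv always advances, while serv
-- advances to serv or oserv according to the entailment I ≤ J, which is decided
-- by excluded middle; either result is below the advanced oserv.

open import Defs
open import Level using (0ℓ)
open import Axiom.ExcludedMiddle using (ExcludedMiddle)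
open import Data.Nat using (ℕ; _+_; _≤_; _∸_)
open import Data.Nat.Properties using (≤-refl; ≤-reflexive)
open import Data.Product using (∃; ∃₂; _×_; _,_)
open import Data.Sum using (_⊎_; inj₁; inj₂)
open import Data.List using (List; []; _∷_)
open import Function using (_∘_)
open import Relation.Nullary using (¬_; yes; no)
open import Relation.Binary.PropositionalEquality using (refl; cong; sym; subst)

-- Φ ⊨ C unfolds to a Π-type over evaluations, so its indices cannot be inferred
-- by unification and are passed explicitly.
module _ {n : ℕ} {Φ : Cstrs n} where

  ⊨-≡-refl : (I : Index n) → Φ ⊨ (I ⟨ eq ⟩ I)
  ⊨-≡-refl I ρ _ = refl

  ⊨-≤-refl : (I : Index n) → Φ ⊨ (I ⟨ le ⟩ I)
  ⊨-≤-refl I ρ _ = ≤-refl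

  ⊨-≡⇒≤ : (I J : Index n) → Φ ⊨ (I ⟨ eq ⟩ J) → Φ ⊨ (I ⟨ le ⟩ J)
  ⊨-≡⇒≤ _ _ e ρ σ = ≤-reflexive (e ρ σ)

  ⊨-≤-respʳ-≡ : (X I J : Index n) → Φ ⊨ (I ⟨ eq ⟩ J) → Φ ⊨ (X ⟨ le ⟩ I) → Φ ⊨ (X ⟨ le ⟩ J)
  ⊨-≤-respʳ-≡ X _ _ e h ρ σ = subst (eval ρ X ≤_) (e ρ σ) (h ρ σ)

  ⊨-≤-respʳ-≡˘ : (X I J : Index n) → Φ ⊨ (J ⟨ eq ⟩ I) → Φ ⊨ (X ⟨ le ⟩ I) → Φ ⊨ (X ⟨ le ⟩ J)
  ⊨-≤-respʳ-≡˘ X _ _ e h ρ σ = subst (eval ρ X ≤_) (sym (e ρ σ)) (h ρ σ)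

  ⊨-∸-congˡ : (X I J : Index n) → Φ ⊨ (I ⟨ eq ⟩ J) → Φ ⊨ ((I ∸ᵢ X) ⟨ eq ⟩ (J ∸ᵢ X))
  ⊨-∸-congˡ X _ _ e ρ σ = cong (_∸ eval ρ X) (e ρ σ)

⊑-base-refl : {n : ℕ} {Φ : Cstrs n} (B : Base n) → Φ ⊢ base B ⊑ base B
⊑-base-refl (Nat I J)   = s-nat (⊨-≤-refl I) (⊨-≤-refl J)
⊑-base-refl (Lst I J B) = s-list (⊨-≤-refl I) (⊨-≤-refl J) (⊑-base-refl B)
⊑-base-refl Bool        = s-bool

⊑-refl : {n : ℕ} {Φ : Cstrs n} (T : Ty n) → Φ ⊢ T ⊑ T
⊑*-refl : {n : ℕ} {Φ : Cstrs n} (Ts : List (Ty n)) → Φ ⊢ Ts ⊑* Ts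

⊑-refl (base B)         = ⊑-base-refl B
⊑-refl (ch I Ts)        = s-ch (⊨-≡-refl I) (⊑*-refl Ts) (⊑*-refl Ts)
⊑-refl (inp I Ts)       = s-in (⊨-≡-refl I) (⊑*-refl Ts)
⊑-refl (out I Ts)       = s-out (⊨-≡-refl I) (⊑*-refl Ts)
⊑-refl (serv I k K Ts)  = s-serv (⊨-≡-refl I) (⊑*-refl Ts) (⊑*-refl Ts) (⊨-≡-refl K)
⊑-refl (iserv I k K Ts) = s-iserv (⊨-≡-refl I) (⊑*-refl Ts) (⊨-≤-refl K)
⊑-refl (oserv I k K Ts) = s-oserv (⊨-≡-refl I) (⊑*-refl Ts) (⊨-≤-refl K)

⊑*-refl []       = []
⊑*-refl (T ∷ Ts) = ⊑-refl T ∷ ⊑*-refl Ts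

module _ (em : ExcludedMiddle 0ℓ) {n : ℕ} {Φ : Cstrs n} {I : Index n} where

  serv-Adv : (J : Index n) (k : ℕ) (K : Index (k + n)) (Ts : List (Ty (k + n))) →
             ∃ λ T' → Adv Φ I (serv J k K Ts) T'
  serv-Adv J k K Ts with em {Φ ⊨ (I ⟨ le ⟩ J)}
  ... | yes h = _ , a-serv h
  ... | no ¬h = _ , a-serv' ¬h

  ⊑-Adv : {T U U' : Ty n} → Φ ⊢ T ⊑ U → Adv Φ I U U' → ∃ λ T' → Adv Φ I T T' × Φ ⊢ T' ⊑ U'
  ⊑-Adv d@(s-nat _ _)    a-base = _ , a-base , d
  ⊑-Adv d@(s-list _ _ _) a-base = _ , a-base , d
  ⊑-Adv s-bool           a-base = _ , a-base , s-bool
  ⊑-Adv s-ch-in          (a-in h)    = _ , a-ch h , s-ch-in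
  ⊑-Adv s-ch-out         (a-out h)   = _ , a-ch h , s-ch-out
  ⊑-Adv s-serv-iserv     (a-iserv h) = _ , a-serv h , s-serv-iserv
  ⊑-Adv (s-serv-oserv {k = k} {I = J} {K = K} {Ts = Ts}) a-oserv with serv-Adv J k K Ts
  ... | _ , a-serv h   = _ , a-serv h , s-serv-oserv
  ... | _ , a-serv' ¬h = _ , a-serv' ¬h , ⊑-refl _
  ⊑-Adv (s-ch {I = J} {J = J'} e p q) (a-ch h) =
    _ , a-ch (⊨-≤-respʳ-≡˘ I J' J e h) , s-ch (⊨-∸-congˡ I J J' e) p q
  ⊑-Adv (s-in {I = J} {J = J'} e p) (a-in h) =
    _ , a-in (⊨-≤-respʳ-≡˘ I J' J e h) , s-in (⊨-∸-congˡ I J J' e) p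
  ⊑-Adv (s-out {I = J} {J = J'} e p) (a-out h) =
    _ , a-out (⊨-≤-respʳ-≡˘ I J' J e h) , s-out (⊨-∸-congˡ I J J' e) p
  ⊑-Adv (s-serv {I = J} {J = J'} e p q r) (a-serv h) =
    _ , a-serv (⊨-≤-respʳ-≡˘ I J' J e h) , s-serv (⊨-∸-congˡ I J J' e) p q r
  ⊑-Adv (s-serv {I = J} {J = J'} {K = K} {K' = K'} e p q r) (a-serv' ¬h) =
    _ , a-serv' (¬h ∘ ⊨-≤-respʳ-≡ I J J' e) , s-oserv (⊨-∸-congˡ I J J' e) q (⊨-≡⇒≤ K K' r)
  ⊑-Adv (s-iserv {I = J} {J = J'} e p r) (a-iserv h) =
    _ , a-iserv (⊨-≤-respʳ-≡˘ I J' J e h) , s-iserv (⊨-∸-congˡ I J J' e) p r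
  ⊑-Adv (s-oserv {I = J} {J = J'} e p r) a-oserv =
    _ , a-oserv , s-oserv (⊨-∸-congˡ I J J' e) p r
  ⊑-Adv (s-trans d₁ d₂) a with ⊑-Adv d₂ a
  ... | _ , a′ , d₂′ with ⊑-Adv d₁ a′
  ...   | _ , a″ , d₁′ = _ , a″ , s-trans d₁′ d₂′

lemma3p4 : ExcludedMiddle 0ℓ →
    {n : ℕ} (Φ : Cstrs n) (T U : Ty n) → Φ ⊢ T ⊑ U → (I : Index n) →
    (¬ (∃ λ U' → Adv Φ I U U'))
    ⊎ (∃₂ λ T' U' → Adv Φ I T T' × Adv Φ I U U' × Φ ⊢ T' ⊑ U')
lemma3p4 em Φ T U d I with em {∃ λ U' → Adv Φ I U U'}
... | no undefined = inj₁ undefined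
... | yes (U' , a) with ⊑-Adv em d a
...   | T' , a′ , d′ = inj₂ (T' , U' , a′ , a , d′)
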